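{- Let $f:2^{\mathcal{N}}\to\mathbb{Z}_{\ge0}$ be a polymatroid with $f(\{e\})>0$ for every $e\in\mathcal{N}$, let $r=f(\mathcal{N})\ge2$, and assume $k^*(f)\ge120\log^2 r$. Let $e_1,\dots,e_n$ be any ordering of $\mathcal{N}$ and let $\mathcal{N}_{\mathsf{good}}$ be the set of good elements (defined in the context). Then (1) $f(\mathcal{N}_{\mathsf{good}})=f(\mathcal{N})$, and (2) $k^*(f_{|\mathcal{N}_{\mathsf{good}}})\ge\frac12 k^*(f)$.
   Context: A polymatroid is an integer-valued, monotone, submodular set function with value $0$ on the empty set. For $A\subseteq\mathcal{N}$ and $S\subseteq \mathcal{N}$, $f_A(S)=f(A\cup S)-f(A)$. For a polymatroid $g$ on ground set $\mathcal{M}$, $k^*(g):=\min_{A\subseteq\mathcal{M}:\, g(A)<g(\mathcal{M})}\left\lfloor\frac{\sum_{e\in\mathcal{M}}(g(A\cup\{e\})-g(A))}{g(\mathcal{M})-g(A)}\right\rfloor$. The restriction $f_{|S}$ is $f$ with ground set restricted to $S$. A set $Q\subseteq\mathcal{V}$ is a quotient of a polymatroid $h$ on $\mathcal{V}$ if $h((\mathcal{V}\setminus Q)\cup\{e\})>h(\mathcal{V}\setminus Q)$ for every $e\in Q$. With $\mathcal{N}_t=\{e_1,\dots,e_t\}$, let $q_t=\min\{|Q|: e_t\in Q\subseteq\mathcal{N}_t,\ Q\text{ a quotient of }f_{|\mathcal{N}_t}\}$. Writing $k^*=k^*(f)$, element $e_t$ is good if $\frac{k^*}{2r}<q_t<2rk^*$;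 $\mathcal{N}_{\mathsf{good}}$ is the set of good elements. Logarithms are base 2. -}

module Defs where

open import Data.Nat using (ℕ; zero; suc; _+_; _*_; _∸_; _^_; _≤_; _<_; _≤ᵇ_)
open import Data.Nat.DivMod using (_/_)
open import Data.Bool using (Bool; true; false; if_then_else_)
open import Data.Fin using (Fin; toℕ)
open import Data.Fin.Subset using (Subset; _∈_; _⊆_; _∪_; _∩_; _─_; ⁅_⁆; ⊥; ⊤; ∣_∣)
open import Data.Vec using (Vec; tabulate; lookup)
import Data.Vec as V
open import Data.Product using (Σ; _×_; ∃)
open import Relation.Binary.PropositionalEquality using (_≡_)

-- The ordering e₁,…,eₙ is the index order of Fin n: e_{t} is the element
-- with toℕ = t - 1 (0-based indices below).

record IsPolymatroid {n : ℕ} (f : Subset n → ℕ) : Set where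
  field
    empty      : f ⊥ ≡ 0
    monotone   : ∀ A B → A ⊆ B → f A ≤ f B
    submodular : ∀ A B → f (A ∪ B) + f (A ∩ B) ≤ f A + f B

-- floor division, a / d; only used with d > 0
fdiv : ℕ → ℕ → ℕ
fdiv a zero    = 0
fdiv a (suc d) = a / suc d

sumOn : {n : ℕ} → Subset n → (Fin n → ℕ) → ℕ
sumOn {n} S g = V.sum (tabulate (λ e → if lookup S e then g e else 0))

ratioOn : {n : ℕ} → (Subset n → ℕ) → Subset n → Subset n → ℕ
ratioOn f S A = fdiv (sumOn S (λ e → f (A ∪ ⁅ e ⁆) ∸ f A)) (f S ∸ f A)

-- IsKStarOn f S m  :⇔  k*(f|S) = m  (m is the minimum of the ratio over A ⊆ S
-- with f(A) < f(S); attained and a lower bound).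
IsKStarOn : {n : ℕ} → (Subset n → ℕ) → Subset n → ℕ → Set
IsKStarOn f S m =
  (Σ _ λ A → A ⊆ S × f A < f S × m ≡ ratioOn f S A)
  × (∀ A → A ⊆ S → f A < f S → m ≤ ratioOn f S A)

-- k ≥ 120 (log₂ r)² , expressed without reals: every nonnegative rational
-- p/q with p/q ≤ log₂ r (i.e. 2^p ≤ r^q) satisfies 120 (p/q)² ≤ k.
-- (Equivalent since log₂ r is the supremum of such rationals.)
LogSqBound : ℕ → ℕ → Set
LogSqBound k r = ∀ p q → 0 < q → 2 ^ p ≤ r ^ q → 120 * p * p ≤ k * q * q

-- 𝒩_t = {e₁,…,e_t}: for 0-based t, the indices i with toℕ i ≤ toℕ t
prefix : {n : ℕ} → Fin n → Subset n
prefix t = tabulate (λ i → toℕ i ≤ᵇ toℕ t)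

IsQuotient : {n : ℕ} → (Subset n → ℕ) → Subset n → Subset n → Set
IsQuotient f V Q = Q ⊆ V × (∀ e → e ∈ Q → f (V ─ Q) < f ((V ─ Q) ∪ ⁅ e ⁆))

IsQ : {n : ℕ} → (Subset n → ℕ) → Fin n → ℕ → Set
IsQ f t m =
  (Σ _ λ Q → IsQuotient f (prefix t) Q × t ∈ Q × ∣ Q ∣ ≡ m)
  × (∀ Q → IsQuotient f (prefix t) Q → t ∈ Q → m ≤ ∣ Q ∣)

-- e_t is good (w.r.t. k = k*(f), r = f(𝒩)): k/(2r) < q_t < 2 r k,
-- with k/(2r) < q_t written as k < 2 r q_t.
Good : {n : ℕ} → (Subset n → ℕ) → ℕ → Fin n → Set
Good f k t = Σ ℕ λ q → IsQ f t q × k < 2 * f ⊤ * q × q < 2 * f ⊤ * k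

-- Call t small if 2r·q_t ≤ k and large if q_t ≥ 2rk; every element outside G is one of
-- the two. There are at most k/2 small elements: removing the last small element together
-- with a short quotient containing it lowers f by at least one, so 2r·|Small| ≤ k·f(Small) ≤ kr.
-- Now let f(A) < r. If no large element increases f over A, the definition of k* gives
-- k(r − f(A)) ≤ Σ_e (f(A+e) − f(A)), and outside G only small elements contribute, each at
-- most r − f(A). Otherwise the first large t that increases f over A makes the increasing
-- elements of its prefix a quotient of f|prefix t, hence at least 2rk of them, all in G or
-- small except t. Either way Σ_{e∈G} (f(A+e) − f(A)) ≥ (k − |Small|)(r − f(A)), which for
-- A = G forces f(G) = r and in general bounds k*(f|G) below by k − |Small| ≥ k/2.

module Submission where

open import Defs
open import Data.Nat using (ℕ; zero; suc; _+_; _*_; _∸_; _≤_; _<_; z≤n; s≤s; s≤s⁻¹; z<s; _≤?_; _<?_; _≟_; >-nonZero)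
open import Data.Nat.Properties
open import Data.Nat.Induction using (<-rec)
open import Data.Nat.DivMod using (_/_; m*n/n≡m; /-monoˡ-≤; m/n*n≤m)
open import Data.Bool using (true; false; _∨_; if_then_else_)
open import Data.Fin using (Fin; toℕ; zero; suc)
open import Data.Fin.Properties using (any?; all?; toℕ-injective; toℕ<n)
open import Data.Fin.Subset using (Subset; _∈_; _∉_; _⊆_; _∪_; _∩_; _─_; _-_; ⁅_⁆; ⊥; ⊤; ∣_∣; Empty; inside; outside)
open import Data.Fin.Subset.Properties
open import Data.Vec using (_∷_; []; tabulate; here; there)
open import Data.Vec.Properties using (lookup∘tabulate; []=⇒lookup; lookup⇒[]=)
open import Data.Product using (Σ; _×_; _,_; proj₁; proj₂; ∃; ∃-syntax)
open import Data.Sum using (_⊎_; inj₁; inj₂; [_,_])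
open import Data.Empty using (⊥-elim)
open import Function using (_∘_; _∘₂_; case_of_)
open import Relation.Nullary using (¬_; Dec; yes; no; does; contradiction)
open import Relation.Nullary.Decidable using (_×-dec_; _→-dec_; dec-true)
open import Level using (0ℓ)
open import Relation.Unary using (Pred; Decidable)
open import Relation.Binary.PropositionalEquality using (_≡_; refl; sym; trans; cong; cong₂; subst; subst₂)
open import Data.Nat.Tactic.RingSolver using (solve-∀)
open import Algebra.Properties.CommutativeSemigroup +-commutativeSemigroup using (interchange)
open import Algebra.Properties.CommutativeSemigroup *-commutativeSemigroup using (xy∙z≈xz∙y)

private
  variable
    n : ℕ

x∈p─q⇒x∉q : ∀ {x : Fin n} {p q} → x ∈ p ─ q → x ∉ q
x∈p─q⇒x∉q {p = inside  ∷ p} {inside ∷ q} () here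
x∈p─q⇒x∉q {p = outside ∷ p} {inside ∷ q} () here
x∈p─q⇒x∉q {p = _ ∷ p} {_ ∷ q} (there x∈p─q) (there x∈q) = x∈p─q⇒x∉q x∈p─q x∈q

∪-lub : ∀ {p q r : Subset n} → p ⊆ r → q ⊆ r → p ∪ q ⊆ r
∪-lub p⊆r q⊆r x∈p∪q = [ p⊆r , q⊆r ] (x∈p∪q⁻ _ _ x∈p∪q)

∩-glb : ∀ {p q r : Subset n} → r ⊆ p → r ⊆ q → r ⊆ p ∩ q
∩-glb r⊆p r⊆q x∈r = x∈p∩q⁺ (r⊆p x∈r , r⊆q x∈r)

∪-mono : ∀ {p p′ q q′ : Subset n} → p ⊆ p′ → q ⊆ q′ → p ∪ q ⊆ p′ ∪ q′
∪-mono p⊆p′ q⊆q′ = ∪-lub (λ x∈p → p⊆p∪q _ (p⊆p′ x∈p)) (λ x∈q → q⊆p∪q _ _ (q⊆q′ x∈q))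

p⊆p─q∪q : ∀ (p q : Subset n) → p ⊆ (p ─ q) ∪ q
p⊆p─q∪q p q {x} x∈p with x ∈? q
... | yes x∈q = q⊆p∪q _ q x∈q
... | no  x∉q = p⊆p∪q q (x∈p∧x∉q⇒x∈p─q x∈p x∉q)

x∈p⇒⁅x⁆⊆p : ∀ {x : Fin n} {p} → x ∈ p → ⁅ x ⁆ ⊆ p
x∈p⇒⁅x⁆⊆p {x = x} x∈p y∈⁅x⁆ = subst (_∈ _) (sym (x∈⁅y⁆⇒x≡y x y∈⁅x⁆)) x∈p

toSubset : {P : Pred (Fin n) 0ℓ} → Decidable P → Subset n
toSubset P? = tabulate (does ∘ P?)

module _ {P : Pred (Fin n) 0ℓ} (P? : Decidable P) where

  ∈-toSubset⁺ : ∀ {x} → P x → x ∈ toSubset P?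
  ∈-toSubset⁺ {x} Px = lookup⇒[]= x _ (trans (lookup∘tabulate _ x) (dec-true (P? x) Px))

  ∈-toSubset⁻ : ∀ {x} → x ∈ toSubset P? → P x
  ∈-toSubset⁻ {x} x∈ with P? x | trans (sym (lookup∘tabulate _ x)) ([]=⇒lookup x∈)
  ... | yes Px | _ = Px
  ... | no _   | ()

-- prefix t is definitionally toSubset (λ x → toℕ x ≤? toℕ t), as _≤?_ is computed by _≤ᵇ_.
∈-prefix⁺ : ∀ {x t : Fin n} → toℕ x ≤ toℕ t → x ∈ prefix t
∈-prefix⁺ {t = t} = ∈-toSubset⁺ (λ x → toℕ x ≤? toℕ t)

∈-prefix⁻ : ∀ {x t : Fin n} → x ∈ prefix t → toℕ x ≤ toℕ t
∈-prefix⁻ {t = t} = ∈-toSubset⁻ (λ x → toℕ x ≤? toℕ t)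

module _ (P : Subset n → Set)
  (P-empty : ∀ S → Empty S → P S)
  (P-step : ∀ S e → e ∈ S → (∀ x → x ∈ S → toℕ x ≤ toℕ e) →
            (∀ S′ → S′ ⊆ S → e ∉ S′ → P S′) → P S)
  where

  private
    bounded : ∀ m S → (∀ x → x ∈ S → toℕ x < m) → P S
    bounded zero S S<0 = P-empty S λ (x , x∈S) → n≮0 (S<0 x x∈S)
    bounded (suc m) S S≤m with any? (λ x → (x ∈? S) ×-dec (toℕ x ≟ m))
    ... | yes (e , e∈S , e≡m) =
      P-step S e e∈S (λ x x∈S → subst (toℕ x ≤_) (sym e≡m) (s≤s⁻¹ (S≤m x x∈S)))
        λ S′ S′⊆S e∉S′ → bounded m S′ λ x x∈S′ →
          ≤∧≢⇒< (s≤s⁻¹ (S≤m x (S′⊆S x∈S′)))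
                λ x≡m → e∉S′ (subst (_∈ S′) (toℕ-injective (trans x≡m (sym e≡m))) x∈S′)
    ... | no m∉S = bounded m S λ x x∈S → ≤∧≢⇒< (s≤s⁻¹ (S≤m x x∈S)) λ x≡m → m∉S (x , x∈S , x≡m)

  max-induction : ∀ S → P S
  max-induction S = bounded n S λ x _ → toℕ<n x

sumOn-const : ∀ (p : Subset n) c → sumOn p (λ _ → c) ≡ ∣ p ∣ * c
sumOn-const []            c = refl
sumOn-const (inside  ∷ p) c = cong (c +_) (sumOn-const p c)
sumOn-const (outside ∷ p) c = sumOn-const p c

∣p∣≡sumOn1 : ∀ (p : Subset n) → ∣ p ∣ ≡ sumOn p (λ _ → 1)
∣p∣≡sumOn1 p = sym (trans (sumOn-const p 1) (*-identityʳ ∣ p ∣))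

sumOn-mono : ∀ {p : Subset n} {v w} → (∀ {x} → x ∈ p → v x ≤ w x) → sumOn p v ≤ sumOn p w
sumOn-mono {p = []}          v≤w = z≤n
sumOn-mono {p = inside  ∷ p} v≤w = +-mono-≤ (v≤w here) (sumOn-mono (v≤w ∘ there))
sumOn-mono {p = outside ∷ p} v≤w = sumOn-mono {p = p} (v≤w ∘ there)

sumOn-support : ∀ {p q : Subset n} w → (∀ {x} → x ∈ q → 0 < w x → x ∈ p) → sumOn q w ≤ sumOn p w
sumOn-support {p = []} {[]} w _ = z≤n
sumOn-support {p = a ∷ p} {outside ∷ q} w supp =
  ≤-trans (sumOn-support (w ∘ suc) (drop-there ∘₂ supp ∘ there)) (m≤n+m _ _)
sumOn-support {p = inside ∷ p} {inside ∷ q} w supp =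
  +-monoʳ-≤ (w zero) (sumOn-support (w ∘ suc) (drop-there ∘₂ supp ∘ there))
sumOn-support {p = outside ∷ p} {inside ∷ q} w supp =
  +-mono-≤ (≮⇒≥ λ w₀>0 → case supp here w₀>0 of λ ())
           (sumOn-support (w ∘ suc) (drop-there ∘₂ supp ∘ there))

sumOn-∪ : ∀ (p q : Subset n) w → sumOn (p ∪ q) w ≤ sumOn p w + sumOn q w
sumOn-∪ []      []      w = z≤n
sumOn-∪ (a ∷ p) (b ∷ q) w =
  ≤-trans (+-mono-≤ (head a) (sumOn-∪ p q (w ∘ suc)))
          (≤-reflexive (interchange (if a then w zero else 0) (if b then w zero else 0) _ _))
  where
  head : ∀ a → (if a ∨ b then w zero else 0) ≤ (if a then w zero else 0) + (if b then w zero else 0)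
  head true  = m≤m+n _ _
  head false = ≤-refl

∣p∪q∣≤∣p∣+∣q∣ : ∀ (p q : Subset n) → ∣ p ∪ q ∣ ≤ ∣ p ∣ + ∣ q ∣
∣p∪q∣≤∣p∣+∣q∣ p q =
  subst₂ _≤_ (sym (∣p∣≡sumOn1 (p ∪ q))) (sym (cong₂ _+_ (∣p∣≡sumOn1 p) (∣p∣≡sumOn1 q))) (sumOn-∪ p q _)

module _ {A : Set} (∃? : ∀ {P : Pred A 0ℓ} → Decidable P → Dec (∃ P)) where

  argmin : (g : A → ℕ) {C : Pred A 0ℓ} → Decidable C → ∃ C → ∃[ a ] C a × (∀ {b} → C b → g a ≤ g b)
  argmin g {C} C? (a₀ , Ca₀) = <-rec Goal step (g a₀) (a₀ , Ca₀ , refl)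
    where
    Goal : ℕ → Set
    Goal m = ∃[ a ] C a × g a ≡ m → ∃[ a ] C a × (∀ {b} → C b → g a ≤ g b)
    step : ∀ m → (∀ {j} → j < m → Goal j) → Goal m
    step m rec (a , Ca , refl) with anyUpTo? (λ j → ∃? (λ b → C? b ×-dec (g b ≟ j))) m
    ... | yes (j , j<m , hit) = rec j<m hit
    ... | no none = a , Ca , λ {b} Cb → ≮⇒≥ λ gb<ga → none (g b , gb<ga , b , Cb , refl)

*≤⇒≤fdiv : ∀ {m s d} → 0 < d → m * d ≤ s → m ≤ fdiv s d
*≤⇒≤fdiv {m} {s} {suc d} _ le = subst (_≤ s / suc d) (m*n/n≡m m (suc d)) (/-monoˡ-≤ (suc d) le)

≤fdiv⇒*≤ : ∀ {m s d} → 0 < d → m ≤ fdiv s d → m * d ≤ s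
≤fdiv⇒*≤ {m} {s} {suc d} _ le = ≤-trans (*-monoˡ-≤ (suc d) le) (m/n*n≤m s (suc d))

2*m≤n⇒m<n : ∀ {m n} → 0 < n → 2 * m ≤ n → m < n
2*m≤n⇒m<n {zero}  0<n _    = 0<n
2*m≤n⇒m<n {suc m} _   2m≤n = <-≤-trans (m<m+n (suc m) z<s) 2m≤n

0<m∸n⇒n<m : ∀ {m n} → 0 < m ∸ n → n < m
0<m∸n⇒n<m = m∸n≢0⇒n<m ∘ >⇒≢

2*m*n≡n*m+n*m : ∀ m n → 2 * m * n ≡ n * m + n * m
2*m*n≡n*m+n*m = solve-∀

2*m≤n⇒n≤2*[n∸m] : ∀ m {n} → 2 * m ≤ n → n ≤ 2 * (n ∸ m)
2*m≤n⇒n≤2*[n∸m] m {n} 2m≤n = begin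
  n                       ≡⟨ m∸n+n≡m (≤-trans (m≤m+n m (m + 0)) 2m≤n) ⟨
  (n ∸ m) + m             ≤⟨ +-monoʳ-≤ (n ∸ m) (m+n≤o⇒m≤o∸n m (subst (_≤ n) (cong (m +_) (+-identityʳ m)) 2m≤n)) ⟩
  (n ∸ m) + (n ∸ m)       ≡⟨ cong ((n ∸ m) +_) (+-identityʳ (n ∸ m)) ⟨
  2 * (n ∸ m)             ∎
  where open ≤-Reasoning

m*o≤n+k*o⇒[m∸k]*o≤n : ∀ {m n} k o → m * o ≤ n + k * o → (m ∸ k) * o ≤ n
m*o≤n+k*o⇒[m∸k]*o≤n {m} {n} k o le = begin
  (m ∸ k) * o       ≡⟨ *-distribʳ-∸ o m k ⟩
  m * o ∸ k * o     ≤⟨ ∸-monoˡ-≤ (k * o) le ⟩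
  n + k * o ∸ k * o ≡⟨ m+n∸n≡m n (k * o) ⟩
  n                 ∎
  where open ≤-Reasoning

module Polymatroid {f : Subset n → ℕ} (P : IsPolymatroid f) where
  open IsPolymatroid P

  marginal : Subset n → Fin n → ℕ
  marginal A e = f (A ∪ ⁅ e ⁆) ∸ f A

  marginal≤ : ∀ A e → marginal A e ≤ f ⊤ ∸ f A
  marginal≤ A e = ∸-monoˡ-≤ (f A) (monotone _ _ ⊆⊤)

  diminishing-returns : ∀ {X Y} x → X ⊆ Y → f (Y ∪ ⁅ x ⁆) + f X ≤ f (X ∪ ⁅ x ⁆) + f Y
  diminishing-returns {X} {Y} x X⊆Y = ≤-trans
    (+-mono-≤ (monotone _ _ (∪-lub (q⊆p∪q _ Y) λ x∈⁅x⁆ → p⊆p∪q Y (q⊆p∪q X _ x∈⁅x⁆)))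
              (monotone _ _ (∩-glb (p⊆p∪q _) X⊆Y)))
    (submodular (X ∪ ⁅ x ⁆) Y)

  increase-antitone : ∀ {X Y} x → X ⊆ Y → f Y < f (Y ∪ ⁅ x ⁆) → f X < f (X ∪ ⁅ x ⁆)
  increase-antitone {X} {Y} x X⊆Y Y<Y+x = +-cancelʳ-< (f Y) (f X) (f (X ∪ ⁅ x ⁆)) (begin-strict
    f X + f Y           <⟨ +-monoʳ-< (f X) Y<Y+x ⟩
    f X + f (Y ∪ ⁅ x ⁆) ≡⟨ +-comm (f X) _ ⟩
    f (Y ∪ ⁅ x ⁆) + f X ≤⟨ diminishing-returns x X⊆Y ⟩
    f (X ∪ ⁅ x ⁆) + f Y ∎)
    where open ≤-Reasoning

  NoIncrease : Subset n → Subset n → Set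
  NoIncrease A W = ∀ {e} → e ∈ W → f (A ∪ ⁅ e ⁆) ≤ f A

  closure : ∀ A W → NoIncrease A W → f (A ∪ W) ≤ f A
  closure A = max-induction (λ W → NoIncrease A W → f (A ∪ W) ≤ f A)
    (λ W W-empty _ → monotone _ _ (∪-lub ⊆-refl λ x∈W → ⊥-elim (W-empty (_ , x∈W))))
    step
    where
    step : ∀ W e → e ∈ W → (∀ x → x ∈ W → toℕ x ≤ toℕ e) →
           (∀ W′ → W′ ⊆ W → e ∉ W′ → NoIncrease A W′ → f (A ∪ W′) ≤ f A) →
           NoIncrease A W → f (A ∪ W) ≤ f A
    step W e e∈W _ ih flat = +-cancelʳ-≤ (f A) _ _ (begin
      f (A ∪ W) + f A                 ≤⟨ +-monoˡ-≤ (f A) (monotone _ _ A∪W⊆) ⟩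
      f ((A ∪ (W - e)) ∪ ⁅ e ⁆) + f A ≤⟨ diminishing-returns e (p⊆p∪q (W - e)) ⟩
      f (A ∪ ⁅ e ⁆) + f (A ∪ (W - e)) ≤⟨ +-mono-≤ (flat e∈W) (ih (W - e) W-e⊆W e∉W-e (flat ∘ W-e⊆W)) ⟩
      f A + f A                       ∎)
      where
      open ≤-Reasoning
      W-e⊆W : W - e ⊆ W
      W-e⊆W = p─q⊆p W ⁅ e ⁆
      e∉W-e : e ∉ W - e
      e∉W-e e∈W-e = x∈p─q⇒x∉q e∈W-e (x∈⁅x⁆ e)
      A∪W⊆ : A ∪ W ⊆ (A ∪ (W - e)) ∪ ⁅ e ⁆
      A∪W⊆ = ∪-lub (λ a → p⊆p∪q _ (p⊆p∪q _ a)) λ w → ∪-mono (q⊆p∪q A _) ⊆-refl (p⊆p─q∪q W ⁅ e ⁆ w)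

  quotient-∩ : ∀ {V V′ Q} → IsQuotient f V Q → V′ ⊆ V → IsQuotient f V′ (Q ∩ V′)
  quotient-∩ {V} {V′} {Q} (_ , Q-inc) V′⊆V =
    p∩q⊆q Q V′ , λ e e∈Q∩V′ → increase-antitone e shrink (Q-inc e (p∩q⊆p Q V′ e∈Q∩V′))
    where
    shrink : V′ ─ (Q ∩ V′) ⊆ V ─ Q
    shrink x∈ = x∈p∧x∉q⇒x∈p─q (V′⊆V (p─q⊆p _ _ x∈)) λ x∈Q → x∈p─q⇒x∉q x∈ (x∈p∩q⁺ (x∈Q , p─q⊆p _ _ x∈))

  quotient? : ∀ V Q → Dec (IsQuotient f V Q)
  quotient? V Q = (Q ⊆? V) ×-dec all? λ e → (e ∈? Q) →-dec (f (V ─ Q) <? f ((V ─ Q) ∪ ⁅ e ⁆))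

  ShortQuotient : ℕ → ℕ → Fin n → Set
  ShortQuotient w k e = ∃[ Q ] IsQuotient f (prefix e) Q × e ∈ Q × w * ∣ Q ∣ ≤ k

  short-quotients⇒card≤ : ∀ w k S → (∀ {e} → e ∈ S → ShortQuotient w k e) → w * ∣ S ∣ ≤ k * f S
  short-quotients⇒card≤ w k = max-induction (λ S → (∀ {e} → e ∈ S → ShortQuotient w k e) → w * ∣ S ∣ ≤ k * f S)
    (λ S S-empty _ → subst (λ c → w * c ≤ k * f S) (sym (trans (cong ∣_∣ (Empty-unique S-empty)) (∣⊥∣≡0 n)))
                           (subst (_≤ k * f S) (sym (*-zeroʳ w)) z≤n))
    step
    where
    step : ∀ S e → e ∈ S → (∀ x → x ∈ S → toℕ x ≤ toℕ e) →
           (∀ S′ → S′ ⊆ S → e ∉ S′ → (∀ {x} → x ∈ S′ → ShortQuotient w k x) → w * ∣ S′ ∣ ≤ k * f S′) →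
           (∀ {x} → x ∈ S → ShortQuotient w k x) → w * ∣ S ∣ ≤ k * f S
    step S e e∈S e-max ih short with short e∈S
    ... | Q , Q-quot , e∈Q , wQ≤k = begin
      w * ∣ S ∣                ≤⟨ *-monoʳ-≤ w (≤-trans (p⊆q⇒∣p∣≤∣q∣ (p⊆p─q∪q S Q′)) (∣p∪q∣≤∣p∣+∣q∣ B Q′)) ⟩
      w * (∣ B ∣ + ∣ Q′ ∣)      ≡⟨ *-distribˡ-+ w ∣ B ∣ ∣ Q′ ∣ ⟩
      w * ∣ B ∣ + w * ∣ Q′ ∣    ≤⟨ +-mono-≤ (ih B (p─q⊆p S Q′) e∉B (short ∘ p─q⊆p S Q′))
                                           (≤-trans (*-monoʳ-≤ w (∣p∩q∣≤∣p∣ Q S)) wQ≤k) ⟩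
      k * f B + k              ≡⟨ +-comm (k * f B) k ⟩
      k + k * f B              ≡⟨ *-suc k (f B) ⟨
      k * suc (f B)            ≤⟨ *-monoʳ-≤ k fB<fS ⟩
      k * f S                  ∎
      where
      open ≤-Reasoning
      Q′ = Q ∩ S
      B = S ─ Q′
      e∈Q′ : e ∈ Q′
      e∈Q′ = x∈p∩q⁺ (e∈Q , e∈S)
      e∉B : e ∉ B
      e∉B e∈B = x∈p─q⇒x∉q e∈B e∈Q′
      fB<fS : f B < f S
      fB<fS = <-≤-trans (proj₂ (quotient-∩ Q-quot λ x∈S → ∈-prefix⁺ (e-max _ x∈S)) e e∈Q′)
                        (monotone _ _ (∪-lub (p─q⊆p S Q′) (x∈p⇒⁅x⁆⊆p e∈S)))

  module _ (singleton-pos : ∀ e → 0 < f ⁅ e ⁆) where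

    quotient-self : ∀ V → IsQuotient f V V
    quotient-self V = ⊆-refl , λ e _ → ≤-trans (s≤s (≤-trans (monotone _ _ V─V⊆⊥) (≤-reflexive empty)))
                                               (≤-trans (singleton-pos e) (monotone _ _ (q⊆p∪q (V ─ V) ⁅ e ⁆)))
      where
      V─V⊆⊥ : V ─ V ⊆ ⊥
      V─V⊆⊥ x∈V─V = ⊥-elim (x∈p─q⇒x∉q x∈V─V (p─q⊆p V V x∈V─V))

    minimal-quotient : ∀ t → ∃ (IsQ f t)
    minimal-quotient t with argmin anySubset? ∣_∣ (λ Q → quotient? (prefix t) Q ×-dec (t ∈? Q))
                                    (prefix t , quotient-self (prefix t) , ∈-prefix⁺ ≤-refl)
    ... | Q , (Q-quot , t∈Q) , Q-min = ∣ Q ∣ , (Q , Q-quot , t∈Q , refl) , λ Q′ Q′-quot t∈Q′ → Q-min (Q′-quot , t∈Q′)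

module GoodElements {f : Subset n → ℕ} (P : IsPolymatroid f) (singleton-pos : ∀ e → 0 < f ⁅ e ⁆)
  (r>0 : 0 < f ⊤) {k : ℕ} (k>0 : 0 < k) (k*-lower : ∀ A → f A < f ⊤ → k ≤ ratioOn f ⊤ A)
  (G : Subset n) (good⇒∈G : ∀ t → Good f k t → t ∈ G)
  where
  open IsPolymatroid P
  open Polymatroid P

  r : ℕ
  r = f ⊤

  q : Fin n → ℕ
  q t = proj₁ (minimal-quotient singleton-pos t)

  q-spec : ∀ t → IsQ f t (q t)
  q-spec t = proj₂ (minimal-quotient singleton-pos t)

  Large : Fin n → Set
  Large t = 2 * r * k ≤ q t

  small? : ∀ t → Dec (2 * r * q t ≤ k)
  small? t = 2 * r * q t ≤? k

  Small : Subset n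
  Small = toSubset small?

  ∉G⇒∈Small⊎Large : ∀ {t} → t ∉ G → t ∈ Small ⊎ Large t
  ∉G⇒∈Small⊎Large {t} t∉G with small? t | q t <? 2 * r * k
  ... | yes small | _      = inj₁ (∈-toSubset⁺ small? small)
  ... | no ¬small | yes q< = ⊥-elim (t∉G (good⇒∈G t (q t , q-spec t , ≰⇒> ¬small , q<)))
  ... | no _      | no ¬q< = inj₂ (≮⇒≥ ¬q<)

  2∣Small∣≤k : 2 * ∣ Small ∣ ≤ k
  2∣Small∣≤k = *-cancelʳ-≤ (2 * ∣ Small ∣) k r ⦃ >-nonZero r>0 ⦄ (begin
    2 * ∣ Small ∣ * r ≡⟨ xy∙z≈xz∙y 2 ∣ Small ∣ r ⟩
    2 * r * ∣ Small ∣ ≤⟨ short-quotients⇒card≤ (2 * r) k Small short ⟩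
    k * f Small       ≤⟨ *-monoʳ-≤ k (monotone _ _ ⊆⊤) ⟩
    k * r         ∎)
    where
    open ≤-Reasoning
    short : ∀ {e} → e ∈ Small → ShortQuotient (2 * r) k e
    short {e} e∈Small with q-spec e
    ... | (Q , Q-quot , e∈Q , ∣Q∣≡q) , _ =
      Q , Q-quot , e∈Q , subst (λ c → 2 * r * c ≤ k) (sym ∣Q∣≡q) (∈-toSubset⁻ small? e∈Small)

  ∣Small∣<k : ∣ Small ∣ < k
  ∣Small∣<k = 2*m≤n⇒m<n k>0 2∣Small∣≤k

  LargeIncrease : Subset n → Fin n → Set
  LargeIncrease A e = Large e × f A < f (A ∪ ⁅ e ⁆)

  large-increase? : ∀ A → Decidable (LargeIncrease A)
  large-increase? A e = (2 * r * k ≤? q e) ×-dec (f A <? f (A ∪ ⁅ e ⁆))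

  module _ (A : Subset n) (fA<r : f A < r) where

    no-large-increase : (∀ {e} → ¬ LargeIncrease A e) → (k ∸ ∣ Small ∣) * (r ∸ f A) ≤ sumOn G (marginal A)
    no-large-increase none = m*o≤n+k*o⇒[m∸k]*o≤n ∣ Small ∣ (r ∸ f A) (begin
      k * (r ∸ f A)                              ≤⟨ ≤fdiv⇒*≤ (m<n⇒0<n∸m fA<r) (k*-lower A fA<r) ⟩
      sumOn ⊤ (marginal A)                       ≤⟨ sumOn-support (marginal A) supported ⟩
      sumOn (G ∪ Small) (marginal A)                 ≤⟨ sumOn-∪ G Small (marginal A) ⟩
      sumOn G (marginal A) + sumOn Small (marginal A) ≤⟨ +-monoʳ-≤ _ (sumOn-mono {p = Small} λ {x} _ → marginal≤ A x) ⟩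
      sumOn G (marginal A) + sumOn Small (λ _ → r ∸ f A) ≡⟨ cong (sumOn G (marginal A) +_) (sumOn-const Small _) ⟩
      sumOn G (marginal A) + ∣ Small ∣ * (r ∸ f A)     ∎)
      where
      open ≤-Reasoning
      supported : ∀ {e} → e ∈ ⊤ → 0 < marginal A e → e ∈ G ∪ Small
      supported {e} _ increase with e ∈? G
      ... | yes e∈G = p⊆p∪q Small e∈G
      ... | no  e∉G = [ q⊆p∪q G Small , (λ large → ⊥-elim (none (large , 0<m∸n⇒n<m increase))) ] (∉G⇒∈Small⊎Large e∉G)

    first-large-increase : ∀ t → LargeIncrease A t → (∀ {e} → LargeIncrease A e → toℕ t ≤ toℕ e) →
                           (k ∸ ∣ Small ∣) * (r ∸ f A) ≤ sumOn G (marginal A)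
    first-large-increase t (t-large , t-inc) t-first = begin
      (k ∸ ∣ Small ∣) * (r ∸ f A) ≤⟨ *-mono-≤ (m∸n≤m k ∣ Small ∣) (m∸n≤m r (f A)) ⟩
      k * r                  ≤⟨ +-cancelʳ-≤ (k * r) _ _ 2kr≤ ⟩
      sumOn G (marginal A)   ∎
      where
      open ≤-Reasoning
      inc? : Decidable (λ e → f A < f (A ∪ ⁅ e ⁆))
      inc? e = f A <? f (A ∪ ⁅ e ⁆)
      Q = prefix t ∩ toSubset inc?
      W = prefix t ─ Q
      inc : ∀ {x} → x ∈ Q → f A < f (A ∪ ⁅ x ⁆)
      inc x∈Q = ∈-toSubset⁻ inc? (p∩q⊆q _ _ x∈Q)
      W-flat : NoIncrease A W
      W-flat x∈W = ≮⇒≥ λ x-inc → x∈p─q⇒x∉q x∈W (x∈p∩q⁺ (p─q⊆p _ _ x∈W , ∈-toSubset⁺ inc? x-inc))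
      Q-quot : IsQuotient f (prefix t) Q
      Q-quot = p∩q⊆p _ _ , λ x x∈Q → increase-antitone x (q⊆p∪q A W)
        (≤-<-trans (closure A W W-flat)
                   (<-≤-trans (inc x∈Q) (monotone _ _ (∪-mono (p⊆p∪q W) ⊆-refl))))
      Q-cover : Q ⊆ (Q ∩ G) ∪ (Small ∪ ⁅ t ⁆)
      Q-cover {x} x∈Q with x ∈? G
      ... | yes x∈G = p⊆p∪q _ (x∈p∩q⁺ (x∈Q , x∈G))
      ... | no  x∉G = q⊆p∪q _ _ ([ p⊆p∪q _ , (λ x-large → q⊆p∪q Small _ (subst (_∈ ⁅ t ⁆) (sym (x≡t x-large)) (x∈⁅x⁆ t))) ]
                                  (∉G⇒∈Small⊎Large x∉G))
        where
        x≡t : Large x → x ≡ t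
        x≡t x-large = toℕ-injective (≤-antisym (∈-prefix⁻ (p∩q⊆p _ _ x∈Q)) (t-first (x-large , inc x∈Q)))
      ∣Q∩G∣≤ : ∣ Q ∩ G ∣ ≤ sumOn G (marginal A)
      ∣Q∩G∣≤ = begin
        ∣ Q ∩ G ∣                    ≡⟨ ∣p∣≡sumOn1 (Q ∩ G) ⟩
        sumOn (Q ∩ G) (λ _ → 1)      ≤⟨ sumOn-mono (λ x∈Q∩G → m<n⇒0<n∸m (inc (p∩q⊆p _ _ x∈Q∩G))) ⟩
        sumOn (Q ∩ G) (marginal A)   ≤⟨ sumOn-support (marginal A) (λ x∈Q∩G _ → p∩q⊆q Q G x∈Q∩G) ⟩
        sumOn G (marginal A)         ∎
      ∣Small∣<kr : ∣ Small ∣ < k * r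
      ∣Small∣<kr = <-≤-trans ∣Small∣<k (m≤m*n k r ⦃ >-nonZero r>0 ⦄)
      2kr≤ : k * r + k * r ≤ sumOn G (marginal A) + k * r
      2kr≤ = begin
        k * r + k * r                       ≡⟨ 2*m*n≡n*m+n*m r k ⟨
        2 * r * k                           ≤⟨ t-large ⟩
        q t                                 ≤⟨ proj₂ (q-spec t) Q Q-quot (x∈p∩q⁺ (∈-prefix⁺ ≤-refl , ∈-toSubset⁺ inc? t-inc)) ⟩
        ∣ Q ∣                               ≤⟨ p⊆q⇒∣p∣≤∣q∣ Q-cover ⟩
        ∣ (Q ∩ G) ∪ (Small ∪ ⁅ t ⁆) ∣           ≤⟨ ∣p∪q∣≤∣p∣+∣q∣ (Q ∩ G) _ ⟩
        ∣ Q ∩ G ∣ + ∣ Small ∪ ⁅ t ⁆ ∣           ≤⟨ +-mono-≤ ∣Q∩G∣≤ (∣p∪q∣≤∣p∣+∣q∣ Small ⁅ t ⁆) ⟩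
        sumOn G (marginal A) + (∣ Small ∣ + ∣ ⁅ t ⁆ ∣) ≡⟨ cong (λ c → sumOn G (marginal A) + (∣ Small ∣ + c)) (∣⁅x⁆∣≡1 t) ⟩
        sumOn G (marginal A) + (∣ Small ∣ + 1)    ≤⟨ +-monoʳ-≤ _ (subst (_≤ k * r) (+-comm 1 ∣ Small ∣) ∣Small∣<kr) ⟩
        sumOn G (marginal A) + k * r        ∎

  marginal-sum≥ : ∀ A → f A < r → (k ∸ ∣ Small ∣) * (r ∸ f A) ≤ sumOn G (marginal A)
  marginal-sum≥ A fA<r with any? (large-increase? A)
  ... | no  none = no-large-increase A fA<r λ large-inc → none (_ , large-inc)
  ... | yes some with argmin any? toℕ (large-increase? A) some
  ...   | t , t-large-inc , t-first = first-large-increase A fA<r t t-large-inc t-first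

  f[G]≡r : f G ≡ r
  f[G]≡r with f G <? r
  ... | no  fG≮r = ≤-antisym (monotone _ _ ⊆⊤) (≮⇒≥ fG≮r)
  ... | yes fG<r = contradiction (begin
    (k ∸ ∣ Small ∣) * (r ∸ f G) ≤⟨ marginal-sum≥ G fG<r ⟩
    sumOn G (marginal G)   ≤⟨ sumOn-mono {p = G} (λ e∈G → ≤-reflexive (m≤n⇒m∸n≡0 (f[G∪⁅e⁆]≤f[G] e∈G))) ⟩
    sumOn G (λ _ → 0)      ≡⟨ sumOn-const G 0 ⟩
    ∣ G ∣ * 0              ≡⟨ *-zeroʳ ∣ G ∣ ⟩
    0                      ∎) (<⇒≱ (*-mono-≤ (m<n⇒0<n∸m ∣Small∣<k) (m<n⇒0<n∸m fG<r)))
    where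
    open ≤-Reasoning
    f[G∪⁅e⁆]≤f[G] : ∀ {e} → e ∈ G → f (G ∪ ⁅ e ⁆) ≤ f G
    f[G∪⁅e⁆]≤f[G] e∈G = monotone _ _ (∪-lub ⊆-refl (x∈p⇒⁅x⁆⊆p e∈G))

  k*[G] : ∃[ k′ ] IsKStarOn f G k′ × k ≤ 2 * k′
  k*[G] with argmin anySubset? (ratioOn f G) (λ A → (A ⊆? G) ×-dec (f A <? f G))
                    (⊥ , ⊥⊆ , subst₂ _<_ (sym empty) (sym f[G]≡r) r>0)
  ... | A₀ , (A₀⊆G , A₀<G) , A₀-min =
    ratioOn f G A₀ , ((A₀ , A₀⊆G , A₀<G , refl) , λ A A⊆G A<G → A₀-min (A⊆G , A<G)) ,
    ≤-trans (2*m≤n⇒n≤2*[n∸m] ∣ Small ∣ 2∣Small∣≤k) (*-monoʳ-≤ 2 (*≤⇒≤fdiv {m = k ∸ ∣ Small ∣} (m<n⇒0<n∸m A₀<G) bound))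
    where
    bound : (k ∸ ∣ Small ∣) * (f G ∸ f A₀) ≤ sumOn G (marginal A₀)
    bound = subst (λ x → (k ∸ ∣ Small ∣) * (x ∸ f A₀) ≤ sumOn G (marginal A₀)) (sym f[G]≡r)
                  (marginal-sum≥ A₀ (subst (f A₀ <_) f[G]≡r A₀<G))

lemma3p2 : (n : ℕ) (f : Subset n → ℕ) → IsPolymatroid f
    → (∀ e → 0 < f ⁅ e ⁆) → 2 ≤ f ⊤
    → (k : ℕ) → IsKStarOn f ⊤ k → LogSqBound k (f ⊤)
    → (G : Subset n) → (∀ t → (t ∈ G → Good f k t) × (Good f k t → t ∈ G))
    → f G ≡ f ⊤ × (Σ ℕ λ k′ → IsKStarOn f G k′ × k ≤ 2 * k′)
lemma3p2 n f P singleton-pos 2≤r k (_ , k*-lower) k≥120log²r G G-spec = f[G]≡r , k*[G]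
  where
  k>0 : 0 < k
  k>0 = <-≤-trans z<s (subst (120 ≤_) (trans (*-identityʳ (k * 1)) (*-identityʳ k))
                        (k≥120log²r 1 1 z<s (subst (2 ≤_) (sym (*-identityʳ (f ⊤))) 2≤r)))
  open GoodElements P singleton-pos (<-≤-trans z<s 2≤r) k>0 (λ A fA<r → k*-lower A ⊆⊤ fA<r) G (proj₂ ∘ G-spec)
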